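{- Let $\alpha$ be an ordinal and $S\subseteq\mathbb{N}^\mathbb{N}$, and let $G:\mathbb{N}^{<\mathbb{N}}\to\{0,1\}$, $H:\mathbb{N}^{<\mathbb{N}}\to\alpha$ witness that $S$ is guessable with $<\alpha$ mind changes. Then there is $H':\mathbb{N}^{<\mathbb{N}}\to\alpha$ such that $G,H'$ also witness that $S$ is guessable with $<\alpha$ mind changes, $H'(\emptyset)=H(\emptyset)$, and for every $f\in\mathbb{N}^\mathbb{N}$ and $n\in\mathbb{N}$: $H'(f\upharpoonright(n+1))\equiv H'(f\upharpoonright n)$ if and only if $G(f\upharpoonright(n+1))=G(f\upharpoonright n)$.
   Context: $\mathbb{N}^{<\mathbb{N}}$ is the set of finite sequences, $\emptyset$ the empty sequence; $f\upharpoonright n$ is the length-$n$ initial segment of $f$; $\chi_S$ is the characteristic function of $S$. $G$ is an $S$-guesser if $\lim_nG(f\upharpoonright n)=\chi_S(f)$ for all $f$. A pair $(G,H)$ with $G:\mathbb{N}^{<\mathbb{N}}\to\{0,1\}$ and $H:\mathbb{N}^{<\mathbb{N}}\to\alpha$ witnesses that $S$ is guessable with $<\alpha$ mind changes if $G$ is an $S$-guesser and for all $f,n$: $H(f\upharpoonright(n+1))\le H(f\upharpoonright n)$, and if $G(f\upharpoonright(n+1))\ne G(f\upharpoonright n)$ then $H(f\upharpoonright(n+1))<H(f\upharpoonright n)$. For ordinals, $\beta\equiv\gamma$ means they have the same parity, where the parity of $\eta=\lambda+n$ ($\lambda$ zero or a limit ordinal, $n\in\mathbb{N}$) is $n\bmod2$.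 -}

module Defs where

open import Data.Nat using (ℕ; zero; suc; _≤_; _%_)
open import Data.Bool using (Bool)
open import Data.List using (List; map; upTo)
open import Data.Product using (Σ; ∃; ∃-syntax; _×_)
open import Data.Sum using (_⊎_)
open import Relation.Nullary using (¬_)
open import Relation.Binary.PropositionalEquality using (_≡_; _≢_)

-- N^{<N} is represented by List ℕ; f ↾ n = [f 0, ..., f (n-1)]
_↾_ : (ℕ → ℕ) → ℕ → List ℕ
f ↾ n = map f (upTo n)

module _ {A : Set} (_<_ : A → A → Set) where

  _≤ₒ_ : A → A → Set
  x ≤ₒ y = (x < y) ⊎ (x ≡ y)

  IsSucc : A → A → Set
  IsSucc x y = (x < y) × (∀ z → ¬ ((x < z) × (z < y)))

  ZeroOrLimit : A → Set
  ZeroOrLimit y = ¬ (∃[ x ] IsSucc x y)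

  SuccIter : ℕ → A → A → Set
  SuccIter zero l b = l ≡ b
  SuccIter (suc n) l b = ∃[ y ] (SuccIter n l y × IsSucc y b)

  Decomp : A → A → ℕ → Set
  Decomp b l n = ZeroOrLimit l × SuccIter n l b

  SameParity : A → A → Set
  SameParity b c = ∃[ l₁ ] ∃[ n₁ ] ∃[ l₂ ] ∃[ n₂ ]
    (Decomp b l₁ n₁ × Decomp c l₂ n₂ × (n₁ % 2 ≡ n₂ % 2))

  -- G is an S-guesser, S given by its characteristic function χ
  IsGuesser : ((ℕ → ℕ) → Bool) → (List ℕ → Bool) → Set
  IsGuesser χ G = ∀ (f : ℕ → ℕ) → ∃[ N ] (∀ n → N ≤ n → G (f ↾ n) ≡ χ f)

  Witnesses : ((ℕ → ℕ) → Bool) → (List ℕ → Bool) → (List ℕ → A) → Set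
  Witnesses χ G H = IsGuesser χ G ×
    (∀ (f : ℕ → ℕ) (n : ℕ) →
        (H (f ↾ suc n) ≤ₒ H (f ↾ n))
      × (G (f ↾ suc n) ≢ G (f ↾ n) → H (f ↾ suc n) < H (f ↾ n)))

-- A parity-changing mind-change counter H' is built along each sequence, starting from H(∅).
-- While the guess stays the same, H' stays the same.  When the guess changes, H has strictly
-- dropped below the current value h of H', and we move to some y with H(new) ≤ y < h of the
-- opposite parity to h: either H(new) already has the other parity, or its successor (which is
-- still < h) does, since a successor flips parity.  The invariant H ≤ H' keeps the next drop
-- possible.
module Submission where

open import Defs
open import Data.Nat using (ℕ; suc; zero; _%_)
open import Data.Bool using (Bool)
open import Data.Bool.Properties using () renaming (_≟_ to _≟ᵇ_)
open import Data.List using (List; []; _∷_; _++_; reverse; map; upTo; [_])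
open import Data.List.Properties using (map-++; upTo-∷ʳ; reverse-++; unfold-reverse; reverse-involutive)
open import Data.Product using (∃-syntax; _×_; _,_; proj₁; proj₂)
open import Data.Sum using (_⊎_; inj₁; inj₂)
open import Data.Empty using (⊥-elim)
open import Relation.Nullary using (¬_; yes; no)
open import Relation.Binary.PropositionalEquality using (_≡_; _≢_; refl; sym; trans; cong; subst; module ≡-Reasoning)
open import Relation.Binary.Structures using (IsStrictTotalOrder)
open import Relation.Binary.Definitions using (tri<; tri≈; tri>)
open import Induction.WellFounded using (WellFounded; Acc; acc)
open import Function.Bundles using (_⇔_; mk⇔)

suc-%2-≢ : ∀ n → suc n % 2 ≢ n % 2
suc-%2-≢ zero ()
suc-%2-≢ (suc zero) ()
suc-%2-≢ (suc (suc n)) eq = suc-%2-≢ n eq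

module Parity (lem : (P : Set) → P ⊎ ¬ P) {A : Set} {_<_ : A → A → Set}
              (sto : IsStrictTotalOrder _≡_ _<_) (wf : WellFounded _<_) where
  open IsStrictTotalOrder sto using (compare) renaming (trans to <-trans)

  _≤_ : A → A → Set
  _≤_ = _≤ₒ_ _<_

  <-≤-trans : ∀ {a b c} → a < b → b ≤ c → a < c
  <-≤-trans a<b (inj₁ b<c) = <-trans a<b b<c
  <-≤-trans a<b (inj₂ refl) = a<b

  ≤-trans : ∀ {a b c} → a ≤ b → b ≤ c → a ≤ c
  ≤-trans (inj₁ a<b) b≤c = inj₁ (<-≤-trans a<b b≤c)
  ≤-trans (inj₂ refl) b≤c = b≤c

  decomposition : ∀ a → ∃[ l ] ∃[ n ] Decomp _<_ a l n
  decomposition a = go a (wf a)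
    where
    go : ∀ a → Acc _<_ a → ∃[ l ] ∃[ n ] Decomp _<_ a l n
    go a (acc rs) with lem (∃[ x ] IsSucc _<_ x a)
    ... | inj₂ limit = a , zero , limit , refl
    ... | inj₁ (x , x⁺≡a) with go x (rs (proj₁ x⁺≡a))
    ... | l , n , limit , iter = l , suc n , limit , (x , iter , x⁺≡a)

  IsSucc-unique : ∀ {y y' a} → IsSucc _<_ y a → IsSucc _<_ y' a → y ≡ y'
  IsSucc-unique {y} {y'} (y<a , gap) (y'<a , gap') with compare y y'
  ... | tri< y<y' _ _ = ⊥-elim (gap y' (y<y' , y'<a))
  ... | tri≈ _ y≡y' _ = y≡y'
  ... | tri> _ _ y'<y = ⊥-elim (gap' y (y'<y , y<a))

  SuccIter-unique : ∀ n n' {a l l'} → ZeroOrLimit _<_ l → ZeroOrLimit _<_ l' →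
                    SuccIter _<_ n l a → SuccIter _<_ n' l' a → n ≡ n'
  SuccIter-unique zero zero _ _ _ _ = refl
  SuccIter-unique zero (suc _) limit _ refl (y , _ , y⁺) = ⊥-elim (limit (y , y⁺))
  SuccIter-unique (suc _) zero _ limit' (y , _ , y⁺) refl = ⊥-elim (limit' (y , y⁺))
  SuccIter-unique (suc n) (suc n') limit limit' (y , iter , y⁺) (y' , iter' , y'⁺)
    with IsSucc-unique y⁺ y'⁺
  ... | refl = cong suc (SuccIter-unique n n' limit limit' iter iter')

  Decomp-unique : ∀ {a l n l' n'} → Decomp _<_ a l n → Decomp _<_ a l' n' → n ≡ n'
  Decomp-unique {n = n} {n' = n'} (limit , iter) (limit' , iter') =
    SuccIter-unique n n' limit limit' iter iter'

  SameParity-refl : ∀ a → SameParity _<_ a a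
  SameParity-refl a with decomposition a
  ... | l , n , d = l , n , l , n , d , d , refl

  IsSucc⇒¬SameParity : ∀ {x s h} → IsSucc _<_ x s → SameParity _<_ x h → ¬ SameParity _<_ s h
  IsSucc⇒¬SameParity x⁺ (_ , n , _ , m , (limit , iter) , dh , n≡m) (_ , k , _ , m' , ds , dh' , k≡m') =
    suc-%2-≢ n (begin
      suc n % 2 ≡⟨ cong (_% 2) (Decomp-unique (limit , (_ , iter , x⁺)) ds) ⟩
      k % 2     ≡⟨ k≡m' ⟩
      m' % 2    ≡⟨ cong (_% 2) (Decomp-unique dh' dh) ⟩
      m % 2     ≡⟨ sym n≡m ⟩
      n % 2     ∎)
    where open ≡-Reasoning

  least : (P : A → Set) → ∀ {z} → P z → ∃[ m ] (P m × (∀ w → w < m → ¬ P w))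
  least P {z} = go z (wf z)
    where
    go : ∀ z → Acc _<_ z → P z → ∃[ m ] (P m × (∀ w → w < m → ¬ P w))
    go z (acc rs) pz with lem (∃[ w ] (w < z × P w))
    ... | inj₁ (w , w<z , pw) = go w (rs w<z) pw
    ... | inj₂ none = z , pz , λ w w<z pw → none (w , w<z , pw)

  successor : ∀ {x h} → x < h → ∃[ s ] IsSucc _<_ x s
  successor x<h with least (_ <_) x<h
  ... | s , x<s , minimal = s , x<s , λ z (x<z , z<s) → minimal z z<s x<z

  parity-change-below : ∀ {x h} → x < h → ∃[ y ] (x ≤ y × y < h × ¬ SameParity _<_ y h)
  parity-change-below {x} {h} x<h with lem (SameParity _<_ x h)
  ... | inj₂ x≁h = x , inj₂ refl , x<h , x≁h
  ... | inj₁ x∼h with successor x<h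
  ... | s , x⁺ with compare s h
  ... | tri< s<h _ _ = s , inj₁ (proj₁ x⁺) , s<h , IsSucc⇒¬SameParity x⁺ x∼h
  ... | tri≈ _ refl _ = ⊥-elim (IsSucc⇒¬SameParity x⁺ x∼h (SameParity-refl s))
  ... | tri> _ _ h<s = ⊥-elim (proj₂ x⁺ h (x<h , h<s))

  -- The fallback value h is junk: lowerTo x h is only used when x < h.
  lowerTo : A → A → A
  lowerTo x h with lem (x < h)
  ... | inj₁ x<h = proj₁ (parity-change-below x<h)
  ... | inj₂ _ = h

  lowerTo-spec : ∀ {x h} → x < h →
                 x ≤ lowerTo x h × lowerTo x h < h × ¬ SameParity _<_ (lowerTo x h) h
  lowerTo-spec {x} {h} x<h with lem (x < h)
  ... | inj₁ x<h' = proj₂ (parity-change-below x<h')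
  ... | inj₂ x≮h = ⊥-elim (x≮h x<h)

↾-suc : ∀ (f : ℕ → ℕ) n → f ↾ suc n ≡ (f ↾ n) ++ [ f n ]
↾-suc f n = trans (cong (map f) (sym (upTo-∷ʳ n))) (map-++ f (upTo n) [ n ])

module Construction (lem : (P : Set) → P ⊎ ¬ P) {A : Set} {_<_ : A → A → Set}
                    (sto : IsStrictTotalOrder _≡_ _<_) (wf : WellFounded _<_)
                    {χ : (ℕ → ℕ) → Bool} (G : List ℕ → Bool) (H : List ℕ → A)
                    (W : Witnesses _<_ χ G H) where
  open Parity lem sto wf

  step : A → List ℕ → List ℕ → A
  step h new old with G new ≟ᵇ G old
  ... | yes _ = h
  ... | no _ = lowerTo (H new) h

  step-same : ∀ h new old → G new ≡ G old → step h new old ≡ h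
  step-same h new old eq with G new ≟ᵇ G old
  ... | yes _ = refl
  ... | no neq = ⊥-elim (neq eq)

  step-change : ∀ h new old → G new ≢ G old → step h new old ≡ lowerTo (H new) h
  step-change h new old neq with G new ≟ᵇ G old
  ... | yes eq = ⊥-elim (neq eq)
  ... | no _ = refl

  -- K runs step along the prefixes of the reversal of its argument, so H' xs is
  -- determined by the values of step on the prefixes of xs.
  K : List ℕ → A
  K [] = H []
  K (x ∷ ys) = step (K ys) (reverse (x ∷ ys)) (reverse ys)

  H' : List ℕ → A
  H' xs = K (reverse xs)

  H'-∷ʳ : ∀ xs x → H' (xs ++ [ x ]) ≡ step (H' xs) (xs ++ [ x ]) xs
  H'-∷ʳ xs x rewrite reverse-++ xs [ x ] | unfold-reverse x (reverse xs)
                   | reverse-involutive xs = refl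

  H'-suc : ∀ f n → H' (f ↾ suc n) ≡ step (H' (f ↾ n)) (f ↾ suc n) (f ↾ n)
  H'-suc f n = subst (λ new → H' new ≡ step (H' (f ↾ n)) new (f ↾ n))
                     (sym (↾-suc f n)) (H'-∷ʳ (f ↾ n) (f n))

  H'-keeps : ∀ f n → G (f ↾ suc n) ≡ G (f ↾ n) → H' (f ↾ suc n) ≡ H' (f ↾ n)
  H'-keeps f n eq = trans (H'-suc f n) (step-same _ _ _ eq)

  H'-lowers : ∀ f n → G (f ↾ suc n) ≢ G (f ↾ n) →
              H' (f ↾ suc n) ≡ lowerTo (H (f ↾ suc n)) (H' (f ↾ n))
  H'-lowers f n neq = trans (H'-suc f n) (step-change _ _ _ neq)

  H≤H' : ∀ f n → H (f ↾ n) ≤ H' (f ↾ n)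
  H-drops-below-H' : ∀ f n → G (f ↾ suc n) ≢ G (f ↾ n) → H (f ↾ suc n) < H' (f ↾ n)

  H≤H' f zero = inj₂ refl
  H≤H' f (suc n) with G (f ↾ suc n) ≟ᵇ G (f ↾ n)
  ... | yes eq rewrite H'-keeps f n eq = ≤-trans (proj₁ (proj₂ W f n)) (H≤H' f n)
  ... | no neq rewrite H'-lowers f n neq = proj₁ (lowerTo-spec (H-drops-below-H' f n neq))

  H-drops-below-H' f n neq = <-≤-trans (proj₂ (proj₂ W f n) neq) (H≤H' f n)

  H'-changes : ∀ f n → G (f ↾ suc n) ≢ G (f ↾ n) →
               H' (f ↾ suc n) < H' (f ↾ n) × ¬ SameParity _<_ (H' (f ↾ suc n)) (H' (f ↾ n))
  H'-changes f n neq rewrite H'-lowers f n neq = proj₂ (lowerTo-spec (H-drops-below-H' f n neq))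

  H'-witnesses : Witnesses _<_ χ G H'
  H'-witnesses = proj₁ W , λ f n → H'-non-increasing f n , λ neq → proj₁ (H'-changes f n neq)
    where
    H'-non-increasing : ∀ f n → H' (f ↾ suc n) ≤ H' (f ↾ n)
    H'-non-increasing f n with G (f ↾ suc n) ≟ᵇ G (f ↾ n)
    ... | yes eq = inj₂ (H'-keeps f n eq)
    ... | no neq = inj₁ (proj₁ (H'-changes f n neq))

  H'-parity : ∀ f n → SameParity _<_ (H' (f ↾ suc n)) (H' (f ↾ n)) ⇔ (G (f ↾ suc n) ≡ G (f ↾ n))
  H'-parity f n = mk⇔ same⇒eq eq⇒same
    where
    same⇒eq : SameParity _<_ (H' (f ↾ suc n)) (H' (f ↾ n)) → G (f ↾ suc n) ≡ G (f ↾ n)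
    same⇒eq same with G (f ↾ suc n) ≟ᵇ G (f ↾ n)
    ... | yes eq = eq
    ... | no neq = ⊥-elim (proj₂ (H'-changes f n neq) same)

    eq⇒same : G (f ↾ suc n) ≡ G (f ↾ n) → SameParity _<_ (H' (f ↾ suc n)) (H' (f ↾ n))
    eq⇒same eq rewrite H'-keeps f n eq = SameParity-refl _

lemma4p6 : ((P : Set) → P ⊎ ¬ P) →
    (A : Set) (_<_ : A → A → Set) →
    IsStrictTotalOrder _≡_ _<_ → WellFounded _<_ →
    (χ : (ℕ → ℕ) → Bool) (G : List ℕ → Bool) (H : List ℕ → A) →
    Witnesses _<_ χ G H →
    ∃[ H' ] (Witnesses _<_ χ G H' × (H' [] ≡ H [])
      × (∀ (f : ℕ → ℕ) (n : ℕ) →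
           (SameParity _<_ (H' (f ↾ suc n)) (H' (f ↾ n)) ⇔ (G (f ↾ suc n) ≡ G (f ↾ n)))))
lemma4p6 lem A _<_ sto wf χ G H W = H' , H'-witnesses , refl , H'-parity
  where open Construction lem sto wf G H W
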